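{- A connected signed simple graph $\Sigma$ with maximum degree $4$ that has a vertex of degree less than $4$ has an acyclic negation set.
   Context: A signed graph is a pair $\Sigma=(\Gamma,\sigma)$ with $\sigma: E(\Gamma)\to\{+,-\}$. The sign of a circle (cycle) is the product of the signs of its edges; a signed graph is balanced if every circle is positive. A negation set is a set of edges whose negation (changing the sign of each of its edges) yields a balanced signed graph. An edge set is acyclic if the graph formed by its edges and their endpoints is a forest. -}

module Defs where

open import Data.Nat using (ℕ; _≤_; _<_)
open import Data.Fin using (Fin)
open import Data.Bool using (Bool; true; false; T; if_then_else_)
open import Data.List using (List; []; _∷_; _++_; [_]; length; map; foldr)
open import Data.Nat.ListAction using (sum)
open import Data.List.Relation.Unary.All using (All)
open import Data.List.Relation.Unary.Unique.Propositional using (Unique)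
open import Data.List using (allFin)
open import Data.Product using (_×_; _,_; ∃-syntax; Σ-syntax)
open import Data.Sign using (Sign; +; -; opposite) renaming (_*_ to _*ˢ_)
open import Relation.Binary.PropositionalEquality using (_≡_)
open import Relation.Nullary using (¬_)

-- A signed simple graph on the vertex set Fin n.
-- adj u v = true iff {u,v} is an edge; irreflexive and symmetric (simple graph).
-- sign u v is the sign of the edge {u,v} (only meaningful when adj u v = true).
record SignedSimpleGraph (n : ℕ) : Set where
  field
    adj      : Fin n → Fin n → Bool
    adj-sym  : ∀ u v → adj u v ≡ adj v u
    adj-irr  : ∀ u → adj u u ≡ false
    sign     : Fin n → Fin n → Sign
    sign-sym : ∀ u v → sign u v ≡ sign v u
open SignedSimpleGraph public

pairs : {A : Set} → List A → List (A × A)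
pairs []           = []
pairs (a ∷ [])     = []
pairs (a ∷ b ∷ xs) = (a , b) ∷ pairs (b ∷ xs)

closedPairs : {A : Set} → List A → List (A × A)
closedPairs []       = []
closedPairs (x ∷ xs) = pairs ((x ∷ xs) ++ [ x ])

record Circle {n : ℕ} (R : Fin n → Fin n → Bool) : Set where
  field
    verts    : List (Fin n)
    long     : 3 ≤ length verts
    distinct : Unique verts
    edges    : All (λ e → T (R (Data.Product.proj₁ e) (Data.Product.proj₂ e)))
                   (closedPairs verts)
open Circle public

circleSign : {n : ℕ} {R : Fin n → Fin n → Bool} →
             (Fin n → Fin n → Sign) → Circle R → Sign
circleSign s C = foldr (λ e acc → s (Data.Product.proj₁ e) (Data.Product.proj₂ e) *ˢ acc)
                       Sign.+ (closedPairs (verts C))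

Balanced : {n : ℕ} → SignedSimpleGraph n → Set
Balanced G = (C : Circle (adj G)) → circleSign (sign G) C ≡ Sign.+

record EdgeSet {n : ℕ} (G : SignedSimpleGraph n) : Set where
  field
    mem     : Fin n → Fin n → Bool
    mem-sym : ∀ u v → mem u v ≡ mem v u
    mem-sub : ∀ u v → T (mem u v) → T (adj G u v)
open EdgeSet public

negate : {n : ℕ} (G : SignedSimpleGraph n) → EdgeSet G → SignedSimpleGraph n
negate G S = record
  { adj      = adj G
  ; adj-sym  = adj-sym G
  ; adj-irr  = adj-irr G
  ; sign     = λ u v → if mem S u v then opposite (sign G u v) else sign G u v
  ; sign-sym = λ u v → lemma u v
  }
  where
  open Relation.Binary.PropositionalEquality using (cong₂; subst; sym)
  lemma : ∀ u v → (if mem S u v then opposite (sign G u v) else sign G u v)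
                ≡ (if mem S v u then opposite (sign G v u) else sign G v u)
  lemma u v rewrite mem-sym S u v | sign-sym G u v = Relation.Binary.PropositionalEquality.refl

IsNegationSet : {n : ℕ} (G : SignedSimpleGraph n) → EdgeSet G → Set
IsNegationSet G S = Balanced (negate G S)

Acyclic : {n : ℕ} {G : SignedSimpleGraph n} → EdgeSet G → Set
Acyclic S = ¬ Circle (mem S)

data Walk {n : ℕ} (R : Fin n → Fin n → Bool) : Fin n → Fin n → Set where
  here : ∀ {u} → Walk R u u
  step : ∀ {u v w} → T (R u v) → Walk R v w → Walk R u w

Connected : {n : ℕ} → SignedSimpleGraph n → Set
Connected G = ∀ u v → Walk (adj G) u v

degree : {n : ℕ} → SignedSimpleGraph n → Fin n → ℕ
degree {n} G u = sum (map (λ v → if adj G u v then 1 else 0) (allFin n))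

MaxDegree : {n : ℕ} → SignedSimpleGraph n → ℕ → Set
MaxDegree G d = (∀ u → degree G u ≤ d) × (∃[ u ] degree G u ≡ d)

-- Negating the edges that are negative after switching by s : V → Sign always balances the
-- graph: every edge uv gets sign s u · s v, and these telescope around any circle.  Let δ be
-- the distance to a vertex r of degree < 4, give the edge uv the weight 1 + min (δ u) (δ v),
-- and switch single vertices as long as this lowers the total weight of negative edges.  At
-- the end, at every vertex the negative edges weigh at most as much as the positive ones.
-- If the negative edges contained a circle, pick a vertex v of least δ on it: its two circle
-- edges weigh δ v + 1 each, so all edges at v together weigh at least 4 (δ v + 1).  But either
-- v = r has at most three edges, or v has a neighbour closer to r and that edge weighs at most
-- δ v; with degree ≤ 4 the total is below 4 (δ v + 1) in both cases.

module Submission where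

open import Defs

open import Data.Nat using (ℕ; zero; suc; _+_; _*_; _⊓_; _≤_; _<_; z≤n; s≤s; s≤s⁻¹; _<?_)
open import Data.Nat.Properties
  using ( ≤-refl; ≤-trans; <-≤-trans; ≤-<-trans; <⇒≱; ≮⇒≥; m≤m+n; m<1+n⇒m<n∨m≡n
        ; +-identityʳ; +-mono-≤; +-monoʳ-≤; +-mono-<; +-monoˡ-<; +-mono-<-≤; +-commutativeSemigroup
        ; *-identityˡ; *-distribʳ-+; *-monoˡ-≤; *-monoˡ-<; ⊓-comm; m⊓n≤m; m⊓n≤n; m≤n⇒m⊓n≡m
        ; module ≤-Reasoning )
open import Data.Nat.ListAction using (sum)
open import Data.Nat.Tactic.RingSolver using (solve-∀)
open import Data.Fin using (Fin; _≟_)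
open import Data.Fin.Properties using (any?)
open import Data.Bool using (Bool; true; false; T; _∧_; not; if_then_else_)
open import Data.Bool.Properties using (T-∧)
open import Data.Sign using (Sign; opposite) renaming (+ to +ˢ; - to -ˢ; _*_ to _*ˢ_)
open import Data.Sign.Properties using ()
  renaming (*-assoc to *ˢ-assoc; *-comm to *ˢ-comm; *-identityʳ to *ˢ-identityʳ; s*s≡+ to s*ˢs≡+)
open import Data.Product using (_×_; _,_; proj₁; proj₂; ∃; ∃₂; ∃-syntax; Σ; Σ-syntax)
open import Data.Sum using (_⊎_; inj₁; inj₂; [_,_]′)
open import Data.Empty using (⊥-elim)
open import Data.List using (List; []; _∷_; _++_; [_]; _∷ʳ_; map; allFin; foldr; length; initLast; _∷ʳ′_)
open import Data.List.Properties using (map-cong; map-cong-local; ++-assoc; ++-identityʳ)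
open import Data.List.Extrema.Nat using (argmin; argmin-sel; f[argmin]≤f[⊤]; f[argmin]≤f[xs])
open import Data.List.Membership.Propositional using (_∈_)
open import Data.List.Membership.Propositional.Properties using (∈-allFin; ∈-∃++; ∈-++⁺ʳ)
open import Data.List.Relation.Unary.All as All using (All; []; _∷_)
import Data.List.Relation.Unary.All.Properties as Allₚ
open import Data.List.Relation.Unary.Any using (here; there)
open import Data.List.Relation.Unary.AllPairs using (_∷_)
open import Data.List.Relation.Unary.Unique.Propositional using (Unique)
open import Data.List.Relation.Unary.Unique.Propositional.Properties using (allFin⁺)
open import Data.List.Relation.Binary.Permutation.Propositional using (_↭_; ↭-sym; ↭⇒↭ₛ)
import Data.List.Relation.Binary.Permutation.Propositional.Properties as ↭
open ↭ using (∈-resp-↭; ↭-length)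
open import Data.List.Relation.Binary.Permutation.Setoid.Properties using (Unique-resp-↭)
open import Function using (id; _∘_; case_of_)
open import Function.Bundles using (Equivalence)
open import Relation.Unary using (Decidable)
open import Relation.Binary.Definitions using (DecidableEquality)
open import Relation.Binary.PropositionalEquality hiding ([_])
open import Relation.Nullary using (¬_; Dec; does; yes; no)
open import Relation.Nullary.Decidable using (dec-true; dec-false; T?; _⊎-dec_; _×-dec_)
open import Algebra.Properties.CommutativeSemigroup +-commutativeSemigroup using (interchange; x∙yz≈y∙xz)

module _ {A : Set} where

  sum-map-mono : ∀ {f g : A → ℕ} → (∀ x → f x ≤ g x) → ∀ xs → sum (map f xs) ≤ sum (map g xs)
  sum-map-mono f≤g []       = z≤n
  sum-map-mono f≤g (x ∷ xs) = +-mono-≤ (f≤g x) (sum-map-mono f≤g xs)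

  sum-map-+ : ∀ (f g : A → ℕ) xs → sum (map (λ x → f x + g x) xs) ≡ sum (map f xs) + sum (map g xs)
  sum-map-+ f g []       = refl
  sum-map-+ f g (x ∷ xs) =
    trans (cong (f x + g x +_) (sum-map-+ f g xs)) (interchange (f x) (g x) _ _)

  sum-map-*ʳ : ∀ (f : A → ℕ) c xs → sum (map (λ x → f x * c) xs) ≡ sum (map f xs) * c
  sum-map-*ʳ f c []       = refl
  sum-map-*ʳ f c (x ∷ xs) =
    trans (cong (f x * c +_) (sum-map-*ʳ f c xs)) (sym (*-distribʳ-+ c (f x) (sum (map f xs))))

module Except {A : Set} (_≟ᴬ_ : DecidableEquality A) where

  except : A → (A → ℕ) → A → ℕ
  except v f x = if does (x ≟ᴬ v) then 0 else f x

  except-self : ∀ v f → except v f v ≡ 0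
  except-self v f = cong (λ b → if b then 0 else f v) (dec-true (v ≟ᴬ v) refl)

  except-≢ : ∀ {v x} f → x ≢ v → except v f x ≡ f x
  except-≢ {v} {x} f x≢v = cong (λ b → if b then 0 else f x) (dec-false (x ≟ᴬ v) x≢v)

  except-cong : ∀ {v} {f g : A → ℕ} → (∀ x → x ≢ v → f x ≡ g x) → ∀ x → except v f x ≡ except v g x
  except-cong {v} f≡g x with x ≟ᴬ v
  ... | yes _   = refl
  ... | no x≢v = f≡g x x≢v

  except-mono : ∀ {v} {f g : A → ℕ} → (∀ x → f x ≤ g x) → ∀ x → except v f x ≤ except v g x
  except-mono {v} f≤g x with x ≟ᴬ v
  ... | yes _ = z≤n
  ... | no _  = f≤g x

  except-+ : ∀ v (f g : A → ℕ) x → except v (λ y → f y + g y) x ≡ except v f x + except v g x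
  except-+ v f g x with x ≟ᴬ v
  ... | yes _ = refl
  ... | no _  = refl

  sum-map-pick : ∀ {v xs} f → Unique xs → v ∈ xs → sum (map f xs) ≡ f v + sum (map (except v f) xs)
  sum-map-pick {v} {x ∷ xs} f (v∉xs ∷ _) (here refl) = cong (f v +_) (begin
      sum (map f xs)                            ≡⟨ cong sum (map-cong-local (All.map (λ v≢y → sym (except-≢ f (≢-sym v≢y))) v∉xs)) ⟩
      sum (map (except v f) xs)                 ≡⟨ cong (_+ sum (map (except v f) xs)) (except-self v f) ⟨
      except v f v + sum (map (except v f) xs)  ∎)
    where open ≡-Reasoning
  sum-map-pick {v} {x ∷ xs} f (x∉xs ∷ xs-unique) (there v∈xs) = begin
      f x + sum (map f xs)                            ≡⟨ cong (f x +_) (sum-map-pick f xs-unique v∈xs) ⟩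
      f x + (f v + sum (map (except v f) xs))         ≡⟨ x∙yz≈y∙xz (f x) (f v) _ ⟩
      f v + (f x + sum (map (except v f) xs))         ≡⟨ cong (λ y → f v + (y + _)) (except-≢ f (All.lookup x∉xs v∈xs)) ⟨
      f v + (except v f x + sum (map (except v f) xs)) ∎
    where open ≡-Reasoning

module _ {n : ℕ} where

  open Except (_≟_ {n}) public

  ∑ : (Fin n → ℕ) → ℕ
  ∑ f = sum (map f (allFin n))

  ∑-cong : ∀ {f g : Fin n → ℕ} → (∀ x → f x ≡ g x) → ∑ f ≡ ∑ g
  ∑-cong f≗g = cong sum (map-cong f≗g (allFin n))

  ∑-mono : ∀ {f g : Fin n → ℕ} → (∀ x → f x ≤ g x) → ∑ f ≤ ∑ g
  ∑-mono f≤g = sum-map-mono f≤g (allFin n)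

  ∑-+ : ∀ (f g : Fin n → ℕ) → ∑ (λ x → f x + g x) ≡ ∑ f + ∑ g
  ∑-+ f g = sum-map-+ f g (allFin n)

  ∑-*ʳ : ∀ (f : Fin n → ℕ) c → ∑ (λ x → f x * c) ≡ ∑ f * c
  ∑-*ʳ f c = sum-map-*ʳ f c (allFin n)

  ∑-pick : ∀ v f → ∑ f ≡ f v + ∑ (except v f)
  ∑-pick v f = sum-map-pick f (allFin⁺ n) (∈-allFin v)

  ∑-mono-< : ∀ {f g : Fin n → ℕ} {v} → (∀ x → f x ≤ g x) → f v < g v → ∑ f < ∑ g
  ∑-mono-< {f} {g} {v} f≤g fv<gv = subst₂ _<_ (sym (∑-pick v f)) (sym (∑-pick v g))
    (+-mono-<-≤ fv<gv (∑-mono (except-mono f≤g)))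

  ∑-except-zero : ∀ {v f} → f v ≡ 0 → ∑ (except v f) ≡ ∑ f
  ∑-except-zero {v} {f} fv≡0 = sym (trans (∑-pick v f) (cong (_+ ∑ (except v f)) fv≡0))

  ∑-pair≤ : ∀ {a b} f → a ≢ b → f a + f b ≤ ∑ f
  ∑-pair≤ {a} {b} f a≢b = begin
    f a + f b                              ≡⟨ cong (f a +_) (except-≢ f (≢-sym a≢b)) ⟨
    f a + except a f b                     ≤⟨ +-monoʳ-≤ (f a) (m≤m+n _ _) ⟩
    f a + (except a f b + ∑ (except b (except a f)))  ≡⟨ cong (f a +_) (∑-pick b (except a f)) ⟨
    f a + ∑ (except a f)                   ≡⟨ ∑-pick a f ⟨
    ∑ f                                    ∎
    where open ≤-Reasoning

  ∑∑ : (Fin n → Fin n → ℕ) → ℕ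
  ∑∑ f = ∑ (λ x → ∑ (f x))

  offPivot : Fin n → (Fin n → Fin n → ℕ) → ℕ
  offPivot v f = ∑ (except v (λ x → ∑ (except v (f x))))

  ∑∑-pivot : ∀ {f} v → (∀ x y → f x y ≡ f y x) → f v v ≡ 0 →
             ∑∑ f ≡ ∑ (f v) + (∑ (f v) + offPivot v f)
  ∑∑-pivot {f} v f-sym fvv≡0 = begin
    ∑∑ f                                                           ≡⟨ ∑-pick v _ ⟩
    ∑ (f v) + ∑ (except v (λ x → ∑ (f x)))                         ≡⟨ cong (∑ (f v) +_) (∑-cong row-split) ⟩
    ∑ (f v) + ∑ (λ x → except v (f v) x + except v offRow x)       ≡⟨ cong (∑ (f v) +_) (∑-+ _ _) ⟩
    ∑ (f v) + (∑ (except v (f v)) + offPivot v f)                  ≡⟨ cong (λ t → ∑ (f v) + (t + offPivot v f)) (∑-except-zero fvv≡0) ⟩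
    ∑ (f v) + (∑ (f v) + offPivot v f)                             ∎
    where
    open ≡-Reasoning
    offRow : Fin n → ℕ
    offRow x = ∑ (except v (f x))
    row-split : ∀ x → except v (λ x → ∑ (f x)) x ≡ except v (f v) x + except v offRow x
    row-split x = trans (except-cong (λ x _ → trans (∑-pick v (f x)) (cong (_+ offRow x) (f-sym x v))) x)
                        (except-+ v (f v) offRow x)

  ∑∑-<-pivot : ∀ {f g} v → (∀ x y → f x y ≡ f y x) → (∀ x y → g x y ≡ g y x) →
               f v v ≡ 0 → g v v ≡ 0 → (∀ x y → x ≢ v → y ≢ v → g x y ≡ f x y) →
               ∑ (g v) < ∑ (f v) → ∑∑ g < ∑∑ f
  ∑∑-<-pivot {f} {g} v f-sym g-sym fvv≡0 gvv≡0 g≡f row< =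
    subst₂ _<_ (sym (trans (∑∑-pivot v g-sym gvv≡0) (cong (λ t → ∑ (g v) + (∑ (g v) + t)) same-off)))
               (sym (∑∑-pivot v f-sym fvv≡0))
               (+-mono-< row< (+-monoˡ-< (offPivot v f) row<))
    where
    same-off : offPivot v g ≡ offPivot v f
    same-off = ∑-cong (except-cong (λ x x≢v → ∑-cong (except-cong (λ y y≢v → g≡f x y x≢v y≢v))))

module _ {P : ℕ → Set} (P? : Decidable P) where

  least-below : ∀ N → (∃ λ m → P m × (∀ {k} → P k → m ≤ k)) ⊎ (∀ {k} → k < N → ¬ P k)
  least-below zero    = inj₂ λ ()
  least-below (suc N) with least-below N
  ... | inj₁ found      = inj₁ found
  ... | inj₂ none-below with P? N
  ...   | yes pN = inj₁ (N , pN , λ pk → ≮⇒≥ (λ k<N → none-below k<N pk))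
  ...   | no ¬pN = inj₂ λ k<1+N → [ none-below , (λ { refl → ¬pN }) ]′ (m<1+n⇒m<n∨m≡n k<1+N)

  least : ∀ {N} → P N → ∃ λ m → P m × (∀ {k} → P k → m ≤ k)
  least {N} pN = [ id , (λ none-below → ⊥-elim (none-below ≤-refl pN)) ]′ (least-below (suc N))

pairs-++ : ∀ {A : Set} (xs : List A) y ys → pairs (xs ++ y ∷ ys) ≡ pairs (xs ++ [ y ]) ++ pairs (y ∷ ys)
pairs-++ []           y ys = refl
pairs-++ (x ∷ [])     y ys = refl
pairs-++ (x ∷ z ∷ xs) y ys = cong ((x , z) ∷_) (pairs-++ (z ∷ xs) y ys)

module _ {A : Set} where

  closedPairs-split : ∀ (x : A) as v bs →
    closedPairs (x ∷ as ++ v ∷ bs) ≡ pairs (x ∷ as ++ [ v ]) ++ pairs (v ∷ bs ++ [ x ])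
  closedPairs-split x as v bs = begin
    pairs (x ∷ (as ++ v ∷ bs) ++ [ x ])                  ≡⟨ cong (λ l → pairs (x ∷ l)) (++-assoc as (v ∷ bs) [ x ]) ⟩
    pairs ((x ∷ as) ++ v ∷ bs ++ [ x ])                  ≡⟨ pairs-++ (x ∷ as) v (bs ++ [ x ]) ⟩
    pairs (x ∷ as ++ [ v ]) ++ pairs (v ∷ bs ++ [ x ])   ∎
    where open ≡-Reasoning

  module _ {Q : A × A → Set} where

    All-closedPairs-rotate : ∀ as v bs → All Q (closedPairs (as ++ v ∷ bs)) → All Q (closedPairs (v ∷ bs ++ as))
    All-closedPairs-rotate []       v bs qs = subst (All Q ∘ closedPairs ∘ (v ∷_)) (sym (++-identityʳ bs)) qs
    All-closedPairs-rotate (x ∷ as) v bs qs =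
      subst (All Q) (sym (closedPairs-split v bs x as)) (Allₚ.++⁺ (Allₚ.++⁻ʳ front qs′) (Allₚ.++⁻ˡ front qs′))
      where
      front = pairs (x ∷ as ++ [ v ])
      qs′ : All Q (front ++ pairs (v ∷ bs ++ [ x ]))
      qs′ = subst (All Q) (closedPairs-split x as v bs) qs

    head-neighbours : ∀ (v : A) ys → 2 ≤ length ys → Unique (v ∷ ys) → All Q (closedPairs (v ∷ ys)) →
                      ∃₂ λ a b → a ∈ ys × b ∈ ys × a ≢ b × Q (a , v) × Q (v , b)
    head-neighbours v (y ∷ zs) _ (_ ∷ y∉zs ∷ _) qs with initLast zs
    head-neighbours v (y ∷ .[]) (s≤s ()) _ _ | []
    ... | zs′ ∷ʳ′ z = z , y , there z∈zs , here refl , ≢-sym (All.lookup y∉zs z∈zs) , Qzv , All.head qs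
      where
      z∈zs : z ∈ zs′ ∷ʳ z
      z∈zs = ∈-++⁺ʳ zs′ (here refl)
      Qzv : Q (z , v)
      Qzv = proj₂ (Allₚ.∷ʳ⁻ {xs = pairs (v ∷ y ∷ zs′ ++ [ z ])}
                            (subst (All Q) (closedPairs-split v (y ∷ zs′) z []) qs))

    rotation-neighbours : ∀ {l v ys} → l ↭ v ∷ ys → 3 ≤ length l → Unique l → All Q (closedPairs (v ∷ ys)) →
                          ∃₂ λ a b → a ∈ l × b ∈ l × a ≢ b × Q (a , v) × Q (v , b)
    rotation-neighbours {l} {v} {ys} rotation 3≤len unique qs
      with head-neighbours v ys (s≤s⁻¹ (subst (3 ≤_) (↭-length rotation) 3≤len))
                                (Unique-resp-↭ (setoid A) (↭⇒↭ₛ rotation) unique) qs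
    ... | a , b , a∈ys , b∈ys , rest = a , b , ∈-unrotate a∈ys , ∈-unrotate b∈ys , rest
      where
      ∈-unrotate : ∀ {x} → x ∈ ys → x ∈ l
      ∈-unrotate = ∈-resp-↭ (↭-sym rotation) ∘ there

circle-neighbours : ∀ {n} {R : Fin n → Fin n → Bool} (C : Circle R) {v} → v ∈ verts C →
                    ∃₂ λ a b → a ∈ verts C × b ∈ verts C × a ≢ b × T (R a v) × T (R v b)
circle-neighbours C {v} v∈C with ∈-∃++ v∈C
... | as , bs , verts≡ = rotation-neighbours rotation (long C) (distinct C)
                           (All-closedPairs-rotate as v bs (subst (All _ ∘ closedPairs) verts≡ (edges C)))
  where
  rotation : verts C ↭ v ∷ bs ++ as
  rotation = subst (_↭ v ∷ bs ++ as) (sym verts≡) (↭.++-comm as (v ∷ bs))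

∃-argmin : ∀ {A : Set} (f : A → ℕ) (xs : List A) → 0 < length xs →
           ∃ λ m → m ∈ xs × All (λ y → f m ≤ f y) xs
∃-argmin f (x ∷ xs) _ =
  argmin f x xs , [ here , there ]′ (argmin-sel f x xs) ,
  f[argmin]≤f[⊤] {f = f} x xs ∷ f[argmin]≤f[xs] {f = f} x xs

*ˢ-telescope : ∀ a b c → a *ˢ b *ˢ (b *ˢ c) ≡ a *ˢ c
*ˢ-telescope a b c = begin
  a *ˢ b *ˢ (b *ˢ c)    ≡⟨ *ˢ-assoc a b (b *ˢ c) ⟩
  a *ˢ (b *ˢ (b *ˢ c))  ≡⟨ cong (a *ˢ_) (*ˢ-assoc b b c) ⟨
  a *ˢ (b *ˢ b *ˢ c)    ≡⟨ cong (λ s → a *ˢ (s *ˢ c)) (s*ˢs≡+ b) ⟩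
  a *ˢ c                ∎
  where open ≡-Reasoning

foldr-pairs-telescope : ∀ {A : Set} (σ : A → A → Sign) (t : A → Sign) x xs y →
  All (λ e → σ (proj₁ e) (proj₂ e) ≡ t (proj₁ e) *ˢ t (proj₂ e)) (pairs (x ∷ xs ++ [ y ])) →
  foldr (λ e acc → σ (proj₁ e) (proj₂ e) *ˢ acc) +ˢ (pairs (x ∷ xs ++ [ y ])) ≡ t x *ˢ t y
foldr-pairs-telescope σ t x []       y (σxy ∷ []) = trans (*ˢ-identityʳ _) σxy
foldr-pairs-telescope σ t x (z ∷ xs) y (σxz ∷ σs) =
  trans (cong₂ _*ˢ_ σxz (foldr-pairs-telescope σ t z xs y σs)) (*ˢ-telescope (t x) (t z) (t y))

isMinus : Sign → Bool
isMinus -ˢ = true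
isMinus +ˢ = false

isMinus-opposite-* : ∀ a σ b → isMinus (opposite a *ˢ σ *ˢ b) ≡ not (isMinus (a *ˢ σ *ˢ b))
isMinus-opposite-* +ˢ +ˢ +ˢ = refl
isMinus-opposite-* +ˢ +ˢ -ˢ = refl
isMinus-opposite-* +ˢ -ˢ +ˢ = refl
isMinus-opposite-* +ˢ -ˢ -ˢ = refl
isMinus-opposite-* -ˢ +ˢ +ˢ = refl
isMinus-opposite-* -ˢ +ˢ -ˢ = refl
isMinus-opposite-* -ˢ -ˢ +ˢ = refl
isMinus-opposite-* -ˢ -ˢ -ˢ = refl

if-T : ∀ {A : Set} {b} {x y : A} → T b → (if b then x else y) ≡ x
if-T {b = true} _ = refl

balanced-if-sign≡product : ∀ {n} (G : SignedSimpleGraph n) (t : Fin n → Sign) →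
  (∀ u v → T (adj G u v) → sign G u v ≡ t u *ˢ t v) → Balanced G
balanced-if-sign≡product G t sign≡ C with verts C | edges C
... | []     | _     = refl
... | x ∷ xs | edges = trans (foldr-pairs-telescope (sign G) t x xs x (All.map (sign≡ _ _) edges))
                             (s*ˢs≡+ (t x))

module _ {n : ℕ} (G : SignedSimpleGraph n) where

  switchedSign : (Fin n → Sign) → Fin n → Fin n → Sign
  switchedSign s u v = s u *ˢ sign G u v *ˢ s v

  negative positive : (Fin n → Sign) → Fin n → Fin n → Bool
  negative s u v = adj G u v ∧ isMinus (switchedSign s u v)
  positive s u v = adj G u v ∧ not (isMinus (switchedSign s u v))

  negative-sym : ∀ s u v → negative s u v ≡ negative s v u
  negative-sym s u v = cong₂ (λ a σ → a ∧ isMinus σ) (adj-sym G u v) (begin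
    s u *ˢ sign G u v *ˢ s v    ≡⟨ cong (λ σ → s u *ˢ σ *ˢ s v) (sign-sym G u v) ⟩
    s u *ˢ sign G v u *ˢ s v    ≡⟨ *ˢ-comm (s u *ˢ sign G v u) (s v) ⟩
    s v *ˢ (s u *ˢ sign G v u)  ≡⟨ cong (s v *ˢ_) (*ˢ-comm (s u) (sign G v u)) ⟩
    s v *ˢ (sign G v u *ˢ s u)  ≡⟨ *ˢ-assoc (s v) (sign G v u) (s u) ⟨
    s v *ˢ sign G v u *ˢ s u    ∎)
    where open ≡-Reasoning

  negative-diag : ∀ s v → negative s v v ≡ false
  negative-diag s v = cong (_∧ isMinus (switchedSign s v v)) (adj-irr G v)

  positive-diag : ∀ s v → positive s v v ≡ false
  positive-diag s v = cong (_∧ not (isMinus (switchedSign s v v))) (adj-irr G v)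

  negatives : (Fin n → Sign) → EdgeSet G
  negatives s = record
    { mem     = negative s
    ; mem-sym = negative-sym s
    ; mem-sub = λ u v → proj₁ ∘ Equivalence.to T-∧
    }

  negatives-sign : ∀ s {u v} → T (adj G u v) → sign (negate G (negatives s)) u v ≡ s u *ˢ s v
  negatives-sign s {u} {v} uv with adj G u v
  ... | true = resign (s u) (sign G u v) (s v)
    where
    resign : ∀ a σ b → (if isMinus (a *ˢ σ *ˢ b) then opposite σ else σ) ≡ a *ˢ b
    resign +ˢ +ˢ +ˢ = refl
    resign +ˢ +ˢ -ˢ = refl
    resign +ˢ -ˢ +ˢ = refl
    resign +ˢ -ˢ -ˢ = refl
    resign -ˢ +ˢ +ˢ = refl
    resign -ˢ +ˢ -ˢ = refl
    resign -ˢ -ˢ +ˢ = refl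
    resign -ˢ -ˢ -ˢ = refl

  negatives-isNegationSet : ∀ s → IsNegationSet G (negatives s)
  negatives-isNegationSet s =
    balanced-if-sign≡product (negate G (negatives s)) s (λ _ _ → negatives-sign s)

  switchAt : Fin n → (Fin n → Sign) → Fin n → Sign
  switchAt v s x = if does (x ≟ v) then opposite (s x) else s x

  switchAt-self : ∀ v s → switchAt v s v ≡ opposite (s v)
  switchAt-self v s = cong (λ b → if b then opposite (s v) else s v) (dec-true (v ≟ v) refl)

  switchAt-≢ : ∀ {v x} s → x ≢ v → switchAt v s x ≡ s x
  switchAt-≢ {v} {x} s x≢v = cong (λ b → if b then opposite (s x) else s x) (dec-false (x ≟ v) x≢v)

  negative-switchAt-≢ : ∀ {v x y} s → x ≢ v → y ≢ v → negative (switchAt v s) x y ≡ negative s x y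
  negative-switchAt-≢ {x = x} {y} s x≢v y≢v =
    cong₂ (λ a b → adj G x y ∧ isMinus (a *ˢ sign G x y *ˢ b)) (switchAt-≢ s x≢v) (switchAt-≢ s y≢v)

  negative-switchAt-edge : ∀ {v y} s → y ≢ v → negative (switchAt v s) v y ≡ positive s v y
  negative-switchAt-edge {v} {y} s y≢v = begin
    adj G v y ∧ isMinus (switchAt v s v *ˢ sign G v y *ˢ switchAt v s y)
      ≡⟨ cong₂ (λ a b → adj G v y ∧ isMinus (a *ˢ sign G v y *ˢ b)) (switchAt-self v s) (switchAt-≢ s y≢v) ⟩
    adj G v y ∧ isMinus (opposite (s v) *ˢ sign G v y *ˢ s y)
      ≡⟨ cong (adj G v y ∧_) (isMinus-opposite-* (s v) (sign G v y) (s y)) ⟩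
    adj G v y ∧ not (isMinus (s v *ˢ sign G v y *ˢ s y))  ∎
    where open ≡-Reasoning

  negative-switchAt-row : ∀ v s y → negative (switchAt v s) v y ≡ positive s v y
  negative-switchAt-row v s y = case y ≟ v of λ where
    (yes refl) → trans (negative-diag (switchAt v s) v) (sym (positive-diag s v))
    (no y≢v)   → negative-switchAt-edge s y≢v

DescendsTo : ∀ {n} → SignedSimpleGraph n → Fin n → (Fin n → ℕ) → Set
DescendsTo G r δ = ∀ x → x ≡ r ⊎ ∃[ y ] T (adj G x y) × δ y < δ x

module _ {n : ℕ} (G : SignedSimpleGraph n) (r : Fin n) where

  Within : ℕ → Fin n → Set
  Within zero    x = x ≡ r
  Within (suc k) x = x ≡ r ⊎ ∃[ y ] T (adj G x y) × Within k y

  within? : ∀ k x → Dec (Within k x)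
  within? zero    x = x ≟ r
  within? (suc k) x = x ≟ r ⊎-dec any? (λ y → T? (adj G x y) ×-dec within? k y)

  walk⇒within : ∀ {x} → Walk (adj G) x r → ∃ λ k → Within k x
  walk⇒within here         = zero , refl
  walk⇒within (step xy w) = let k , within = walk⇒within w in suc k , inj₂ (_ , xy , within)

  connected⇒descendsTo : Connected G → Σ (Fin n → ℕ) (DescendsTo G r)
  connected⇒descendsTo connected = δ , λ x → descend (δ x) (δ-within x)
    where
    least-within : ∀ x → ∃ λ m → Within m x × (∀ {k} → Within k x → m ≤ k)
    least-within x = least (λ k → within? k x) (proj₂ (walk⇒within (connected x r)))
    δ : Fin n → ℕ
    δ x = proj₁ (least-within x)
    δ-within : ∀ x → Within (δ x) x
    δ-within x = proj₁ (proj₂ (least-within x))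
    δ-least : ∀ {k x} → Within k x → δ x ≤ k
    δ-least {x = x} = proj₂ (proj₂ (least-within x))
    descend : ∀ {x} m → Within m x → x ≡ r ⊎ ∃[ y ] T (adj G x y) × δ y < m
    descend zero    x≡r                 = inj₁ x≡r
    descend (suc k) (inj₁ x≡r)          = inj₁ x≡r
    descend (suc k) (inj₂ (y , xy , w)) = inj₂ (y , xy , s≤s (δ-least w))

module Potential {n : ℕ} (G : SignedSimpleGraph n) (δ : Fin n → ℕ) where

  weight : Fin n → Fin n → ℕ
  weight x y = suc (δ x ⊓ δ y)

  weightIf : Bool → Fin n → Fin n → ℕ
  weightIf b x y = if b then weight x y else 0

  negativeWeight positiveWeight : (Fin n → Sign) → Fin n → Fin n → ℕ
  negativeWeight s x y = weightIf (negative G s x y) x y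
  positiveWeight s x y = weightIf (positive G s x y) x y

  load : Fin n → ℕ
  load v = ∑ (λ y → weightIf (adj G v y) v y)

  negativeLoad positiveLoad : (Fin n → Sign) → Fin n → ℕ
  negativeLoad s v = ∑ (negativeWeight s v)
  positiveLoad s v = ∑ (positiveWeight s v)

  potential : (Fin n → Sign) → ℕ
  potential s = ∑∑ (negativeWeight s)

  negativeWeight-sym : ∀ s x y → negativeWeight s x y ≡ negativeWeight s y x
  negativeWeight-sym s x y =
    cong₂ (λ b m → if b then suc m else 0) (negative-sym G s x y) (⊓-comm (δ x) (δ y))

  negativeWeight-diag : ∀ s x → negativeWeight s x x ≡ 0
  negativeWeight-diag s x = cong (λ b → weightIf b x x) (negative-diag G s x)

  negativeLoad+positiveLoad : ∀ s v → negativeLoad s v + positiveLoad s v ≡ load v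
  negativeLoad+positiveLoad s v = trans (sym (∑-+ (negativeWeight s v) (positiveWeight s v)))
    (∑-cong (λ y → split (adj G v y) (isMinus (switchedSign G s v y)) (weight v y)))
    where
    split : ∀ a b m → (if a ∧ b then m else 0) + (if a ∧ not b then m else 0) ≡ (if a then m else 0)
    split true  true  m = +-identityʳ m
    split true  false m = refl
    split false b     m = refl

  potential-switchAt-< : ∀ {s v} → positiveLoad s v < negativeLoad s v →
                         potential (switchAt G v s) < potential s
  potential-switchAt-< {s} {v} pos<neg =
    ∑∑-<-pivot v (negativeWeight-sym s) (negativeWeight-sym s′) (negativeWeight-diag s v) (negativeWeight-diag s′ v)
      (λ x y x≢v y≢v → cong (λ b → weightIf b x y) (negative-switchAt-≢ G s x≢v y≢v))
      (subst (_< negativeLoad s v) (sym (∑-cong row≡)) pos<neg)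
    where
    s′ = switchAt G v s
    row≡ : ∀ y → negativeWeight s′ v y ≡ positiveWeight s v y
    row≡ y = cong (λ b → weightIf b v y) (negative-switchAt-row G v s y)

  LocallyOptimal : (Fin n → Sign) → Set
  LocallyOptimal s = ∀ v → negativeLoad s v ≤ positiveLoad s v

  locallyOptimal-below : ∀ k s → potential s < k → ∃ LocallyOptimal
  locallyOptimal-below (suc k) s potential<1+k with any? (λ v → positiveLoad s v <? negativeLoad s v)
  ... | yes (v , pos<neg) = locallyOptimal-below k (switchAt G v s)
                              (<-≤-trans (potential-switchAt-< pos<neg) (s≤s⁻¹ potential<1+k))
  ... | no ¬improvable    = s , λ v → ≮⇒≥ (λ pos<neg → ¬improvable (v , pos<neg))

  locallyOptimal-exists : ∃ LocallyOptimal
  locallyOptimal-exists = locallyOptimal-below _ (λ _ → +ˢ) ≤-refl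

  weightIf≤ : ∀ b v y → weightIf b v y ≤ (if b then 1 else 0) * suc (δ v)
  weightIf≤ true  v y = subst (weight v y ≤_) (sym (*-identityˡ _)) (s≤s (m⊓n≤m (δ v) (δ y)))
  weightIf≤ false v y = z≤n

  ∑-degree : ∀ v → ∑ (λ y → (if adj G v y then 1 else 0) * suc (δ v)) ≡ degree G v * suc (δ v)
  ∑-degree v = ∑-*ʳ (λ y → if adj G v y then 1 else 0) (suc (δ v))

  load≤ : ∀ v → load v ≤ degree G v * suc (δ v)
  load≤ v = subst (load v ≤_) (∑-degree v) (∑-mono (λ y → weightIf≤ (adj G v y) v y))

  load<-descent : ∀ {v u} → T (adj G v u) → δ u < δ v → load v < degree G v * suc (δ v)
  load<-descent {v} {u} vu δu<δv = subst (load v <_) (∑-degree v)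
    (∑-mono-< (λ y → weightIf≤ (adj G v y) v y) (begin-strict
      weightIf (adj G v u) v u                ≡⟨ if-T vu ⟩
      suc (δ v ⊓ δ u)                          ≤⟨ s≤s (m⊓n≤n (δ v) (δ u)) ⟩
      suc (δ u)                                ≤⟨ δu<δv ⟩
      δ v                                      <⟨ ≤-refl ⟩
      suc (δ v)                                ≡⟨ *-identityˡ _ ⟨
      1 * suc (δ v)                            ≡⟨ cong (_* suc (δ v)) (if-T vu) ⟨
      (if adj G v u then 1 else 0) * suc (δ v) ∎))
    where open ≤-Reasoning

  4*suc≤load : ∀ {s v a b} → LocallyOptimal s → a ≢ b → T (negative G s v a) → T (negative G s v b) →
          δ v ≤ δ a → δ v ≤ δ b → 4 * suc (δ v) ≤ load v
  4*suc≤load {s} {v} {a} {b} optimal a≢b va vb δv≤δa δv≤δb = begin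
    4 * D                                ≡⟨ four-times D ⟩
    (D + D) + (D + D)                    ≤⟨ +-mono-≤ two≤negative (≤-trans two≤negative (optimal v)) ⟩
    negativeLoad s v + positiveLoad s v  ≡⟨ negativeLoad+positiveLoad s v ⟩
    load v                               ∎
    where
    open ≤-Reasoning
    D = suc (δ v)
    four-times : ∀ m → 4 * m ≡ (m + m) + (m + m)
    four-times = solve-∀
    full-weight : ∀ {x} → T (negative G s v x) → δ v ≤ δ x → negativeWeight s v x ≡ D
    full-weight vx δv≤δx = trans (if-T vx) (cong suc (m≤n⇒m⊓n≡m δv≤δx))
    two≤negative : D + D ≤ negativeLoad s v
    two≤negative = subst₂ (λ p q → p + q ≤ negativeLoad s v) (full-weight va δv≤δa) (full-weight vb δv≤δb)
                          (∑-pair≤ (negativeWeight s v) a≢b)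

  load<4*suc : ∀ {r} → DescendsTo G r δ → (∀ v → degree G v ≤ 4) → degree G r < 4 →
               ∀ v → load v < 4 * suc (δ v)
  load<4*suc {r} descends maxdeg deg-r v with descends v
  ... | inj₁ refl             = ≤-<-trans (load≤ r) (*-monoˡ-< (suc (δ r)) deg-r)
  ... | inj₂ (u , vu , δu<δv) = <-≤-trans (load<-descent vu δu<δv) (*-monoˡ-≤ (suc (δ v)) (maxdeg v))

  negatives-acyclic : ∀ {r s} → DescendsTo G r δ → (∀ v → degree G v ≤ 4) → degree G r < 4 →
                      LocallyOptimal s → Acyclic (negatives G s)
  negatives-acyclic {r} {s} descends maxdeg deg-r optimal C
    with ∃-argmin δ (verts C) (<-≤-trans (s≤s z≤n) (long C))
  ... | v , v∈C , v-minimal with circle-neighbours C v∈C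
  ...   | a , b , a∈C , b∈C , a≢b , av , vb =
    <⇒≱ (load<4*suc descends maxdeg deg-r v)
        (4*suc≤load {s} optimal a≢b (subst T (negative-sym G s a v) av) vb
                    (All.lookup v-minimal a∈C) (All.lookup v-minimal b∈C))

corollary4p8 : (n : ℕ) (G : SignedSimpleGraph n) →
    Connected G → MaxDegree G 4 → (∃[ u ] degree G u < 4) →
    Σ[ S ∈ EdgeSet G ] (IsNegationSet G S × Acyclic S)
corollary4p8 n G connected (maxdeg , _) (r , deg-r) =
  let δ , descends = connected⇒descendsTo G r connected
      s , optimal  = Potential.locallyOptimal-exists G δ
  in negatives G s ,
     negatives-isNegationSet G s ,
     Potential.negatives-acyclic G δ {s = s} descends maxdeg deg-r optimal
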